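{- For all $n\geq 0$, the set $\mathcal{C}_{(0)}\cap\mathrm{DP}_n$ is $n$-opposite to itself, where $\mathcal{C}_{(0)}=\bigcup_{\ell=0}^{\infty}\{\nu^m((\ell,\ell-1,\ldots,2,1)):0\leq m\leq\ell\}$ (for $\ell=0$ the partition $(\ell,\ldots,1)$ is the empty partition $(0)$).
   Context: Partitions are identified up to trailing zeros; $\ell(\gamma)$ is the number of nonzero parts, $|\gamma|$ the sum of parts; the diagram of $\gamma$ is $\{(i,j):1\leq i\leq\ell(\gamma),1\leq j\leq\gamma_i\}$. For a cell $c=(i,j)$, $\mathrm{arm}(c)=\gamma_i-j$, $\mathrm{leg}(c)=\gamma'_j-i$ ($\gamma'$ the conjugate). $\mathrm{dinv}(\gamma)$ is the number of cells with $\mathrm{arm}(c)-\mathrm{leg}(c)\in\{0,1\}$. $\gamma\in\mathrm{DP}_n$ means the diagram of $\gamma$ is contained in that of $(n-1,n-2,\ldots,1,0)$; then $\mathrm{area}_n(\gamma)=\binom{n}{2}-|\gamma|$. Subsets $B,C\subseteq\mathrm{DP}_n$ are $n$-opposite if there is a unique bijection $g:B\to C$ with $\mathrm{area}_n(\gamma)=\mathrm{dinv}(g(\gamma))$ and $\mathrm{dinv}(\gamma)=\mathrm{area}_n(g(\gamma))$ for all $\gamma\in B$. If $\gamma_1\leq\ell(\gamma)+2$, $\nu(\gamma)=(\ell(\gamma)+1,\gamma_1-1,\ldots,\gamma_{\ell(\gamma)}-1)$; $\nu^m$ is the $m$-fold iterate. -}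

module Defs where

open import Data.Nat using (ℕ; zero; suc; _+_; _∸_; _≤_; _≤?_; _≟_; pred)
open import Data.Nat.Combinatorics using (_C_)
open import Data.Bool using (Bool; _∨_)
open import Data.List using (List; []; _∷_; length; map; filter; concatMap; upTo)
open import Data.Nat.ListAction using (sum)
open import Relation.Nullary using (yes; no)
open import Data.Bool using (true; T?)
open import Data.List.Relation.Unary.All using (All)
open import Data.List.Relation.Unary.Linked using (Linked)
open import Data.Maybe using (Maybe; just; nothing; _>>=_)
open import Data.Product using (Σ; _×_; _,_; proj₁; ∃-syntax)
open import Data.Nat using (_≥_)
open import Relation.Nullary.Decidable using (⌊_⌋)
open import Relation.Binary.PropositionalEquality using (_≡_)
import Relation.Binary.PropositionalEquality as ≡
open import Relation.Binary.Bundles using (Setoid)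
import Relation.Binary.Construct.On as On
open import Function.Bundles using (Bijection)

-- Partitions are lists of positive, weakly decreasing natural numbers
-- (this fixes the representative without trailing zeros).
IsPartition : List ℕ → Set
IsPartition γ = All (λ x → 1 ≤ x) γ × Linked _≥_ γ

-- i-th part, 1-indexed, with default 0 (γ_0 and γ_i for i > ℓ(γ) are 0)
part : List ℕ → ℕ → ℕ
part []      _             = 0
part (x ∷ γ) zero          = 0
part (x ∷ γ) (suc zero)    = x
part (x ∷ γ) (suc (suc i)) = part γ (suc i)

len : List ℕ → ℕ
len γ = length γ

conj : List ℕ → ℕ → ℕ
conj γ j = length (filter (λ x → j ≤? x) γ)

size : List ℕ → ℕ
size γ = sum γ

cells : List ℕ → List (ℕ × ℕ)
cells γ = concatMap (λ i → map (λ j → (suc i , suc j)) (upTo (part γ (suc i))))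
                    (upTo (len γ))

arm : List ℕ → ℕ × ℕ → ℕ
arm γ (i , j) = part γ i ∸ j

leg : List ℕ → ℕ × ℕ → ℕ
leg γ (i , j) = conj γ j ∸ i

-- arm(c) − leg(c) ∈ {0,1}  (arm, leg ≥ 0 on cells of the diagram)
dinvCell : List ℕ → ℕ × ℕ → Bool
dinvCell γ c = ⌊ arm γ c ≟ leg γ c ⌋ ∨ ⌊ arm γ c ≟ suc (leg γ c) ⌋

dinv : List ℕ → ℕ
dinv γ = length (filter (λ c → T? (dinvCell γ c)) (cells γ))

-- γ ∈ DP_n : diagram contained in that of (n-1, n-2, …, 1, 0), i.e. γ_i ≤ n − i for all i ≥ 1
InDP : ℕ → List ℕ → Set
InDP n γ = IsPartition γ × (∀ i → 1 ≤ i → part γ i ≤ n ∸ i)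

area : ℕ → List ℕ → ℕ
area n γ = (n C 2) ∸ size γ

-- ν(γ) = (ℓ(γ)+1, γ_1 − 1, …, γ_ℓ − 1), defined only when γ_1 ≤ ℓ(γ) + 2;
-- zero parts produced by γ_i − 1 are removed (identification up to trailing zeros).
ν : List ℕ → Maybe (List ℕ)
ν γ with part γ 1 ≤? len γ + 2
... | yes _ = just (suc (len γ) ∷ filter (λ x → 1 ≤? x) (map pred γ))
... | no  _ = nothing

νIter : ℕ → List ℕ → Maybe (List ℕ)
νIter zero    γ = just γ
νIter (suc m) γ = νIter m γ >>= ν

staircase : ℕ → List ℕ
staircase zero    = []
staircase (suc l) = suc l ∷ staircase l

InC0 : List ℕ → Set
InC0 γ = ∃[ l ] ∃[ m ] (m ≤ l × νIter m (staircase l) ≡ just γ)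

El : (List ℕ → Set) → Set
El B = Σ (List ℕ) B

ElSetoid : (B : List ℕ → Set) → Setoid _ _
ElSetoid B = On.setoid {B = El B} (≡.setoid (List ℕ)) proj₁

module _ (n : ℕ) (B C : List ℕ → Set) where
  Swaps : Bijection (ElSetoid B) (ElSetoid C) → Set
  Swaps g = ∀ (x : El B) →
      (area n (proj₁ x) ≡ dinv (proj₁ (Bijection.to g x)))
    × (dinv (proj₁ x) ≡ area n (proj₁ (Bijection.to g x)))

  NOpposite : Set
  NOpposite = (∀ γ → B γ → InDP n γ) × (∀ γ → C γ → InDP n γ)
            × Σ (Bijection (ElSetoid B) (ElSetoid C)) λ g → Swaps g
              × (∀ h → Swaps h → ∀ x → proj₁ (Bijection.to h x) ≡ proj₁ (Bijection.to g x))

C0∩DP : ℕ → List ℕ → Set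
C0∩DP n γ = InC0 γ × InDP n γ

module Submission where

-- Write Δ_l for the staircase (l, l-1, …, 1) and raised l m for Δ_l with its
-- first m parts increased by one.  The proof has four ingredients.
--  (1) ν^m(Δ_l) = raised l m for m ≤ l, so C_(0) = { raised l m : m ≤ l }.
--  (2) In raised l m every cell has arm − leg ∈ {0,1}; for such "balanced"
--      partitions dinv = |γ|, since the diagram has exactly |γ| cells.
--  (3) |raised l m| = T_l + m (T_l the l-th triangular number), and every
--      s ∈ ℕ is T_l + m for exactly one pair m ≤ l; hence an element of
--      C_(0) is determined by its size and every size occurs.
--  (4) DP_n consists of partitions of size ≤ T_{n-1} = (n choose 2), and the
--      element of C_(0) of size s ≤ T_{n-1} lies in DP_n.
-- A general criterion then finishes the proof: a family S ⊆ DP_n with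
-- dinv = size, on which size is injective and takes every value in
-- [0, (n choose 2)], is n-opposite to itself via γ ↦ the member of size
-- (n choose 2) − |γ|, and this is the only area/dinv-swapping map.

open import Defs
open import Data.Nat using (ℕ; zero; suc; pred; _+_; _∸_; _≤_; _<_; _≥_; _≤?_; _<?_; _≟_; z≤n; s≤s)
open import Data.Nat.Properties
open import Data.Nat.Combinatorics using (_C_; nCk+nC[k+1]≡[n+1]C[k+1]; nC1≡n)
open import Data.Nat.ListAction using (sum)
open import Data.Bool using (T; T?; _∨_)
open import Data.Bool.Properties using (T-∨)
open import Data.List using (List; []; _∷_; length; map; filter; concat; upTo; applyUpTo)
open import Data.List.Properties
  using (filter-all; filter-accept; filter-reject; length-++; length-map; length-upTo; map-upTo; map-cong; map-∘)
open import Data.List.Relation.Unary.All as All using (All; []; _∷_)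
open import Data.List.Relation.Unary.All.Properties using (concat⁺; map⁺; applyUpTo⁺₁)
open import Data.List.Relation.Unary.Linked using (Linked; []; [-]; _∷_)
open import Data.Maybe using (just)
open import Data.Maybe.Properties using (just-injective)
open import Data.Product using (Σ; _×_; _,_; proj₁; proj₂)
open import Data.Sum as Sum using (_⊎_; inj₁; inj₂)
open import Data.Empty using (⊥-elim)
open import Relation.Nullary using (yes; no; ¬_)
open import Relation.Nullary.Decidable using (⌊_⌋; fromWitness)
open import Relation.Binary.Definitions using (tri<; tri≈; tri>)
open import Relation.Binary.PropositionalEquality
open import Function.Bundles using (Bijection; Equivalence)

tri : ℕ → ℕ
tri zero    = 0
tri (suc k) = suc k + tri k

tri-pred : ∀ n → n + tri (pred n) ≡ tri n
tri-pred zero    = refl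
tri-pred (suc n) = refl

-- The number of cells of DP_n's bounding staircase: (n choose 2) = T_{n-1}.
choose2≡tri : ∀ n → n C 2 ≡ tri (pred n)
choose2≡tri zero    = refl
choose2≡tri (suc n) = begin
  suc n C 2           ≡⟨ sym (nCk+nC[k+1]≡[n+1]C[k+1] n 1) ⟩
  n C 1 + n C 2       ≡⟨ cong₂ _+_ (nC1≡n n) (choose2≡tri n) ⟩
  n + tri (pred n)    ≡⟨ tri-pred n ⟩
  tri n               ∎
  where open ≡-Reasoning

tri-mono-≤ : ∀ {a b} → a ≤ b → tri a ≤ tri b
tri-mono-≤ z≤n     = z≤n
tri-mono-≤ (s≤s p) = +-mono-≤ (s≤s p) (tri-mono-≤ p)

tri-mono-< : ∀ {a b} → a < b → tri a < tri b
tri-mono-< {a} {suc b} (s≤s p) = s≤s (≤-trans (tri-mono-≤ p) (m≤n+m (tri b) b))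

tri-cancel-≤ : ∀ {a b} → tri a ≤ tri b → a ≤ b
tri-cancel-≤ {a} {b} p with a ≤? b
... | yes a≤b = a≤b
... | no  a≰b = ⊥-elim (<⇒≱ (tri-mono-< (≰⇒> a≰b)) p)

tri-cancel-< : ∀ {a b} → tri a < tri b → a < b
tri-cancel-< {a} {b} p with a <? b
... | yes a<b = a<b
... | no  a≮b = ⊥-elim (<⇒≱ p (tri-mono-≤ (≮⇒≥ a≮b)))

tri-interval-< : ∀ {l m l' m'} → m ≤ l → l < l' → tri l + m < tri l' + m'
tri-interval-< {l} {m} {l'} {m'} m≤l l<l' = begin-strict
  tri l + m     ≤⟨ +-monoʳ-≤ (tri l) m≤l ⟩
  tri l + l     ≡⟨ +-comm (tri l) l ⟩
  l + tri l     <⟨ n<1+n _ ⟩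
  tri (suc l)   ≤⟨ tri-mono-≤ l<l' ⟩
  tri l'        ≤⟨ m≤m+n (tri l') m' ⟩
  tri l' + m'   ∎
  where open ≤-Reasoning

tri-decomposition-unique : ∀ {l m l' m'} → m ≤ l → m' ≤ l' →
  tri l + m ≡ tri l' + m' → l ≡ l' × m ≡ m'
tri-decomposition-unique {l} {m} {l'} {m'} m≤l m'≤l' e with <-cmp l l'
... | tri< l<l' _ _ = ⊥-elim (<⇒≢ (tri-interval-< m≤l l<l') e)
... | tri> _ _ l>l' = ⊥-elim (<⇒≢ (tri-interval-< m'≤l' l>l') (sym e))
... | tri≈ _ refl _ = refl , +-cancelˡ-≡ (tri l) m m' e

-- Existence of the representation, by counting up: T_l + l + 1 = T_{l+1} + 0.
tri-decomposition : ∀ s → Σ ℕ λ l → Σ ℕ λ m → m ≤ l × tri l + m ≡ s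
tri-decomposition zero = 0 , 0 , z≤n , refl
tri-decomposition (suc s) with tri-decomposition s
... | l , m , m≤l , e with m <? l
...   | yes m<l = l , suc m , m<l , trans (+-suc (tri l) m) (cong suc e)
...   | no  m≮l = suc l , 0 , z≤n , (begin
        tri (suc l) + 0    ≡⟨ +-identityʳ _ ⟩
        suc (l + tri l)    ≡⟨ cong suc (+-comm l (tri l)) ⟩
        suc (tri l + l)    ≡⟨ cong (λ k → suc (tri l + k)) (≤-antisym (≮⇒≥ m≮l) m≤l) ⟩
        suc (tri l + m)    ≡⟨ cong suc e ⟩
        suc s              ∎)
  where open ≡-Reasoning

raised : ℕ → ℕ → List ℕ
raised l       zero    = staircase l
raised zero    (suc m) = []
raised (suc l) (suc m) = suc (suc l) ∷ raised l m

staircase-bounded : ∀ l → All (_≤ l) (staircase l)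
staircase-bounded zero    = []
staircase-bounded (suc l) = ≤-refl ∷ All.map m≤n⇒m≤1+n (staircase-bounded l)

raised-bounded : ∀ l m → All (_≤ suc l) (raised l m)
raised-bounded l       zero    = All.map m≤n⇒m≤1+n (staircase-bounded l)
raised-bounded zero    (suc m) = []
raised-bounded (suc l) (suc m) = ≤-refl ∷ All.map m≤n⇒m≤1+n (raised-bounded l m)

staircase-positive : ∀ l → All (1 ≤_) (staircase l)
staircase-positive zero    = []
staircase-positive (suc l) = s≤s z≤n ∷ staircase-positive l

raised-positive : ∀ l m → All (1 ≤_) (raised l m)
raised-positive l       zero    = staircase-positive l
raised-positive zero    (suc m) = []
raised-positive (suc l) (suc m) = s≤s z≤n ∷ raised-positive l m

linked-cons : ∀ {x} xs → All (_≤ x) xs → Linked _≥_ xs → Linked _≥_ (x ∷ xs)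
linked-cons []       _       _  = [-]
linked-cons (y ∷ ys) (p ∷ _) lk = p ∷ lk

staircase-decreasing : ∀ l → Linked _≥_ (staircase l)
staircase-decreasing zero    = []
staircase-decreasing (suc l) =
  linked-cons (staircase l) (All.map m≤n⇒m≤1+n (staircase-bounded l)) (staircase-decreasing l)

raised-decreasing : ∀ l m → Linked _≥_ (raised l m)
raised-decreasing l       zero    = staircase-decreasing l
raised-decreasing zero    (suc m) = []
raised-decreasing (suc l) (suc m) =
  linked-cons (raised l m) (All.map m≤n⇒m≤1+n (raised-bounded l m)) (raised-decreasing l m)

raised-partition : ∀ l m → IsPartition (raised l m)
raised-partition l m = raised-positive l m , raised-decreasing l m

length-staircase : ∀ l → len (staircase l) ≡ l
length-staircase zero    = refl
length-staircase (suc l) = cong suc (length-staircase l)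

length-raised : ∀ l m → m ≤ l → len (raised l m) ≡ l
length-raised l       zero    _       = length-staircase l
length-raised (suc l) (suc m) (s≤s p) = cong suc (length-raised l m p)

size-staircase : ∀ l → size (staircase l) ≡ tri l
size-staircase zero    = refl
size-staircase (suc l) = cong (suc l +_) (size-staircase l)

size-raised : ∀ l m → m ≤ l → size (raised l m) ≡ tri l + m
size-raised l       zero    _       = trans (size-staircase l) (sym (+-identityʳ _))
size-raised (suc l) (suc m) (s≤s p) = begin
  suc (suc l) + size (raised l m)   ≡⟨ cong (suc (suc l) +_) (size-raised l m p) ⟩
  suc (suc l) + (tri l + m)         ≡⟨ cong suc (sym (+-assoc (suc l) (tri l) m)) ⟩
  suc (tri (suc l) + m)             ≡⟨ sym (+-suc (tri (suc l)) m) ⟩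
  tri (suc l) + suc m               ∎
  where open ≡-Reasoning

part-bounded : ∀ {x} γ → All (_≤ x) γ → ∀ i → part γ i ≤ x
part-bounded []      _        i             = z≤n
part-bounded (y ∷ γ) _        zero          = z≤n
part-bounded (y ∷ γ) (p ∷ _)  (suc zero)    = p
part-bounded (y ∷ γ) (_ ∷ ps) (suc (suc i)) = part-bounded γ ps (suc i)

-- ν removes the first column: decrementing all parts and deleting zeros
-- turns Δ_l into Δ_{l-1} and raised l m into raised (l-1) m.
lower : List ℕ → List ℕ
lower γ = filter (1 ≤?_) (map pred γ)

lower-staircase : ∀ l → lower (staircase l) ≡ staircase (pred l)
lower-staircase zero          = refl
lower-staircase (suc zero)    = refl
lower-staircase (suc (suc l)) = cong (suc l ∷_) (lower-staircase (suc l))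

lower-raised : ∀ l m → m ≤ pred l → lower (raised l m) ≡ raised (pred l) m
lower-raised l             zero    _       = lower-staircase l
lower-raised (suc (suc l)) (suc m) (s≤s p) = cong (suc (suc l) ∷_) (lower-raised (suc l) m p)

ν-defined : ∀ γ → part γ 1 ≤ len γ + 2 → ν γ ≡ just (suc (len γ) ∷ lower γ)
ν-defined γ p with part γ 1 ≤? len γ + 2
... | yes _ = refl
... | no  q = ⊥-elim (q p)

-- ν is defined on every raised staircase: its first row is at most l + 1.
ν-defined-raised : ∀ l m → m ≤ l → part (raised l m) 1 ≤ len (raised l m) + 2
ν-defined-raised l m m≤l rewrite length-raised l m m≤l =
  ≤-trans (part-bounded (raised l m) (raised-bounded l m) 1)
          (≤-trans (n≤1+n _) (≤-reflexive (+-comm 2 l)))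

-- ν^m(Δ_l) = raised l m: each application of ν turns the first column of
-- length l into a new first row of length l + 1.
ν-iterate-staircase : ∀ l m → m ≤ l → νIter m (staircase l) ≡ just (raised l m)
ν-iterate-staircase l       zero    _       = refl
ν-iterate-staircase (suc l) (suc m) (s≤s p)
  rewrite ν-iterate-staircase (suc l) m (m≤n⇒m≤1+n p)
        | ν-defined (raised (suc l) m) (ν-defined-raised (suc l) m (m≤n⇒m≤1+n p))
        | length-raised (suc l) m (m≤n⇒m≤1+n p)
        | lower-raised (suc l) m p = refl

C0-raised : ∀ {γ} → InC0 γ → Σ ℕ λ l → Σ ℕ λ m → m ≤ l × γ ≡ raised l m
C0-raised (l , m , m≤l , eq) =
  l , m , m≤l , just-injective (trans (sym eq) (ν-iterate-staircase l m m≤l))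

conj-accept : ∀ {j} x γ → suc j ≤ x → conj (x ∷ γ) (suc j) ≡ suc (conj γ (suc j))
conj-accept {j} x γ p = cong length (filter-accept (suc j ≤?_) {x} {γ} p)

conj-reject : ∀ {j} x γ → ¬ (suc j ≤ x) → conj (x ∷ γ) (suc j) ≡ conj γ (suc j)
conj-reject {j} x γ p = cong length (filter-reject (suc j ≤?_) {x} {γ} p)

ArmLegBalanced : ℕ → ℕ → Set
ArmLegBalanced a b = a ≡ b ⊎ a ≡ suc b

Balanced : List ℕ → Set
Balanced γ = ∀ i j → i < len γ → j < part γ (suc i) →
  ArmLegBalanced (arm γ (suc i , suc j)) (leg γ (suc i , suc j))

-- Prepending a row x that bounds all parts of γ: the old cells keep their arms
-- and legs, so balance of x ∷ γ reduces to balance of γ and of the new row,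
-- whose cell (1, j+1) has arm x − (j+1) and leg γ'_{j+1}.
balanced-cons : ∀ x γ → All (_≤ x) γ →
  (∀ j → j < x → ArmLegBalanced (x ∸ suc j) (conj γ (suc j))) →
  Balanced γ → Balanced (x ∷ γ)
balanced-cons x γ bounded first-row balanced zero j _ j<x =
  subst (λ c → ArmLegBalanced (x ∸ suc j) (c ∸ 1)) (sym (conj-accept x γ j<x)) (first-row j j<x)
balanced-cons x γ bounded first-row balanced (suc i) j (s≤s i<l) j<p =
  subst (λ c → ArmLegBalanced (part γ (suc i) ∸ suc j) (c ∸ suc (suc i)))
        (sym (conj-accept x γ (≤-trans j<p (part-bounded γ bounded (suc i)))))
        (balanced i j i<l j<p)

conj-staircase : ∀ l j → conj (staircase l) (suc j) ≡ l ∸ j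
conj-staircase zero    j = sym (0∸n≡0 j)
conj-staircase (suc l) j with j ≤? l
... | yes j≤l = begin
  conj (suc l ∷ staircase l) (suc j)   ≡⟨ conj-accept (suc l) (staircase l) (s≤s j≤l) ⟩
  suc (conj (staircase l) (suc j))     ≡⟨ cong suc (conj-staircase l j) ⟩
  suc (l ∸ j)                          ≡⟨ sym (+-∸-assoc 1 j≤l) ⟩
  suc l ∸ j                            ∎
  where open ≡-Reasoning
... | no j≰l = begin
  conj (suc l ∷ staircase l) (suc j)   ≡⟨ conj-reject (suc l) (staircase l) (λ { (s≤s j≤l) → j≰l j≤l }) ⟩
  conj (staircase l) (suc j)           ≡⟨ conj-staircase l j ⟩
  l ∸ j                                ≡⟨ m≤n⇒m∸n≡0 (m≤n⇒m≤1+n (≰⇒> j≰l)) ⟩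
  0                                    ≡⟨ sym (m≤n⇒m∸n≡0 (≰⇒> j≰l)) ⟩
  suc l ∸ j                            ∎
  where open ≡-Reasoning

-- Column j+1 of raised l m has height l+1−j or l−j, so a row of length l+2
-- placed on top of raised l m is balanced (this is the first row of raised (l+1) (m+1)).
conj-raised : ∀ l m j → ArmLegBalanced (suc l ∸ j) (conj (raised l m) (suc j))
conj-raised l zero j with j ≤? l
... | yes j≤l = inj₂ (trans (+-∸-assoc 1 j≤l) (cong suc (sym (conj-staircase l j))))
... | no  j≰l = inj₁ (begin
  suc l ∸ j                    ≡⟨ m≤n⇒m∸n≡0 (≰⇒> j≰l) ⟩
  0                            ≡⟨ sym (m≤n⇒m∸n≡0 (m≤n⇒m≤1+n (≰⇒> j≰l))) ⟩
  l ∸ j                        ≡⟨ sym (conj-staircase l j) ⟩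
  conj (staircase l) (suc j)   ∎)
  where open ≡-Reasoning
conj-raised zero    (suc m) zero    = inj₂ refl
conj-raised zero    (suc m) (suc j) = inj₁ (0∸n≡0 j)
conj-raised (suc l) (suc m) j with j ≤? suc l
... | yes j≤l
  rewrite conj-accept (suc (suc l)) (raised l m) (s≤s j≤l) | +-∸-assoc 1 j≤l
  with conj-raised l m j
...   | inj₁ e = inj₁ (cong suc e)
...   | inj₂ e = inj₂ (cong suc e)
conj-raised (suc l) (suc m) j | no j≰l
  rewrite conj-reject (suc (suc l)) (raised l m) (λ { (s≤s j≤l) → j≰l j≤l })
        | m≤n⇒m∸n≡0 (≰⇒> j≰l)
  with conj-raised l m j
...   | inj₁ e = inj₁ (trans (sym (m≤n⇒m∸n≡0 (<⇒≤ (≰⇒> j≰l)))) e)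
...   | inj₂ e = ⊥-elim (0≢1+n (trans (sym (m≤n⇒m∸n≡0 (<⇒≤ (≰⇒> j≰l)))) e))

balanced-staircase : ∀ l → Balanced (staircase l)
balanced-staircase zero    i j ()
balanced-staircase (suc l) =
  balanced-cons (suc l) (staircase l) (All.map m≤n⇒m≤1+n (staircase-bounded l))
    (λ j _ → inj₁ (sym (conj-staircase l j))) (balanced-staircase l)

balanced-raised : ∀ l m → Balanced (raised l m)
balanced-raised l       zero    = balanced-staircase l
balanced-raised zero    (suc m) i j ()
balanced-raised (suc l) (suc m) =
  balanced-cons (suc (suc l)) (raised l m) (All.map m≤n⇒m≤1+n (raised-bounded l m))
    (λ j _ → conj-raised l m j) (balanced-raised l m)

length-concat : ∀ {A : Set} (xss : List (List A)) → length (concat xss) ≡ sum (map length xss)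
length-concat []         = refl
length-concat (xs ∷ xss) = trans (length-++ xs) (cong (length xs +_) (length-concat xss))

parts-list : ∀ γ → applyUpTo (λ i → part γ (suc i)) (len γ) ≡ γ
parts-list []      = refl
parts-list (x ∷ γ) = cong (x ∷_) (parts-list γ)

length-cells : ∀ γ → length (cells γ) ≡ size γ
length-cells γ = begin
  length (cells γ)                                       ≡⟨ length-concat (map row rows) ⟩
  sum (map length (map row rows))                        ≡⟨ cong sum (sym (map-∘ rows)) ⟩
  sum (map (λ i → length (row i)) rows)                  ≡⟨ cong sum (map-cong length-row rows) ⟩
  sum (map (λ i → part γ (suc i)) rows)                  ≡⟨ cong sum (map-upTo _ (len γ)) ⟩
  sum (applyUpTo (λ i → part γ (suc i)) (len γ))         ≡⟨ cong sum (parts-list γ) ⟩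
  sum γ                                                  ∎
  where
  open ≡-Reasoning
  rows : List ℕ
  rows = upTo (len γ)
  row : ℕ → List (ℕ × ℕ)
  row i = map (λ j → (suc i , suc j)) (upTo (part γ (suc i)))
  length-row : ∀ i → length (row i) ≡ part γ (suc i)
  length-row i = trans (length-map _ (upTo (part γ (suc i)))) (length-upTo _)

dinv-balanced : ∀ γ → Balanced γ → dinv γ ≡ size γ
dinv-balanced γ balanced =
  trans (cong length (filter-all (λ c → T? (dinvCell γ c)) every-cell-counts)) (length-cells γ)
  where
  counts : ∀ {a b} → ArmLegBalanced a b → T (⌊ a ≟ b ⌋ ∨ ⌊ a ≟ suc b ⌋)
  counts {a} {b} e = Equivalence.from (T-∨ {⌊ a ≟ b ⌋} {⌊ a ≟ suc b ⌋})
    (Sum.map (fromWitness {a? = a ≟ b}) (fromWitness {a? = a ≟ suc b}) e)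
  every-cell-counts : All (λ c → T (dinvCell γ c)) (cells γ)
  every-cell-counts = concat⁺ (map⁺ (applyUpTo⁺₁ (λ i → i) (len γ) (λ {i} i<l →
    map⁺ (applyUpTo⁺₁ (λ j → j) (part γ (suc i)) (λ {j} j<p → counts (balanced i j i<l j<p))))))

BelowStaircase : ℕ → List ℕ → Set
BelowStaircase n γ = ∀ i → 1 ≤ i → part γ i ≤ n ∸ i

below-cons : ∀ n x γ → x ≤ pred n → BelowStaircase (pred n) γ → BelowStaircase n (x ∷ γ)
below-cons n       x γ x≤ below zero          ()
below-cons zero    x γ x≤ below (suc zero)    _ = x≤
below-cons (suc n) x γ x≤ below (suc zero)    _ = x≤
below-cons zero    x γ x≤ below (suc (suc i)) _ = below (suc i) (s≤s z≤n)
below-cons (suc n) x γ x≤ below (suc (suc i)) _ = below (suc i) (s≤s z≤n)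

below-uncons : ∀ n x γ → BelowStaircase n (x ∷ γ) → x ≤ pred n × BelowStaircase (pred n) γ
below-uncons zero    x γ below = below 1 (s≤s z≤n) , λ { (suc i) _ → below (suc (suc i)) (s≤s z≤n) }
below-uncons (suc n) x γ below = below 1 (s≤s z≤n) , λ { (suc i) _ → below (suc (suc i)) (s≤s z≤n) }

size-below : ∀ n γ → BelowStaircase n γ → size γ ≤ tri (pred n)
size-below n []      _     = z≤n
size-below n (x ∷ γ) below with below-uncons n x γ below
... | x≤ , below′ = begin
  x + size γ                     ≤⟨ +-mono-≤ x≤ (size-below (pred n) γ below′) ⟩
  pred n + tri (pred (pred n))   ≡⟨ tri-pred (pred n) ⟩
  tri (pred n)                   ∎
  where open ≤-Reasoning

size-DP : ∀ n γ → InDP n γ → size γ ≤ n C 2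
size-DP n γ (_ , below) = ≤-trans (size-below n γ below) (≤-reflexive (sym (choose2≡tri n)))

staircase-below : ∀ l k → l ≤ pred k → BelowStaircase k (staircase l)
staircase-below zero    k _   i _ = z≤n
staircase-below (suc l) k l≤k =
  below-cons k (suc l) (staircase l) l≤k (staircase-below l (pred k) (pred-mono-≤ l≤k))

raised-below : ∀ l m k → suc l ≤ pred k → BelowStaircase k (raised l m)
raised-below l       zero    k l<k = staircase-below l k (<⇒≤ l<k)
raised-below zero    (suc m) k _   i _ = z≤n
raised-below (suc l) (suc m) k l<k =
  below-cons k (suc (suc l)) (raised l m) l<k (raised-below l m (pred k) (pred-mono-≤ l<k))

-- A raised staircase with at most (n choose 2) cells lies in DP_n: its size
-- T_l + m pins down how far its rows reach.
raised-in-DP : ∀ n l m → m ≤ l → tri l + m ≤ n C 2 → InDP n (raised l m)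
raised-in-DP n l m m≤l fits = raised-partition l m , below m (≤-trans fits (≤-reflexive (choose2≡tri n)))
  where
  below : ∀ m → tri l + m ≤ tri (pred n) → BelowStaircase n (raised l m)
  below zero    fits′ = staircase-below l n (tri-cancel-≤ (≤-trans (m≤m+n (tri l) 0) fits′))
  below (suc m) fits′ = raised-below l (suc m) n
    (tri-cancel-< (<-≤-trans (m<m+n (tri l) (s≤s z≤n)) fits′))

C0-dinv≡size : ∀ {γ} → InC0 γ → dinv γ ≡ size γ
C0-dinv≡size c with C0-raised c
... | l , m , _ , refl = dinv-balanced (raised l m) (balanced-raised l m)

C0-size-injective : ∀ {γ γ′} → InC0 γ → InC0 γ′ → size γ ≡ size γ′ → γ ≡ γ′
C0-size-injective c c′ e with C0-raised c | C0-raised c′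
... | l , m , m≤l , refl | l′ , m′ , m′≤l′ , refl
  with tri-decomposition-unique m≤l m′≤l′ (trans (sym (size-raised l m m≤l)) (trans e (size-raised l′ m′ m′≤l′)))
...   | refl , refl = refl

C0-realise : ∀ n s → s ≤ n C 2 → Σ (List ℕ) λ γ → C0∩DP n γ × size γ ≡ s
C0-realise n s s≤ with tri-decomposition s
... | l , m , m≤l , e =
  raised l m ,
  ((l , m , m≤l , ν-iterate-staircase l m m≤l) , raised-in-DP n l m m≤l (subst (_≤ n C 2) (sym e) s≤)) ,
  trans (size-raised l m m≤l) e

module SelfOpposite
  (n : ℕ) (S : List ℕ → Set)
  (S⊆DP : ∀ γ → S γ → InDP n γ)
  (dinv≡size : ∀ {γ} → S γ → dinv γ ≡ size γ)
  (size-injective : ∀ {γ γ′} → S γ → S γ′ → size γ ≡ size γ′ → γ ≡ γ′)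
  (realise : ∀ s → s ≤ n C 2 → Σ (List ℕ) λ γ → S γ × size γ ≡ s)
  where

  N : ℕ
  N = n C 2

  size≤N : ∀ (x : El S) → size (proj₁ x) ≤ N
  size≤N (γ , sγ) = size-DP n γ (S⊆DP γ sγ)

  same-size : ∀ (x y : El S) → size (proj₁ x) ≡ size (proj₁ y) → proj₁ x ≡ proj₁ y
  same-size (_ , sγ) (_ , sγ′) = size-injective sγ sγ′

  complement-of : ∀ (x : El S) → Σ (List ℕ) λ γ → S γ × size γ ≡ N ∸ size (proj₁ x)
  complement-of x = realise (N ∸ size (proj₁ x)) (m∸n≤m N (size (proj₁ x)))

  complement : El S → El S
  complement x = proj₁ (complement-of x) , proj₁ (proj₂ (complement-of x))

  size-complement : ∀ (x : El S) → size (proj₁ (complement x)) ≡ N ∸ size (proj₁ x)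
  size-complement x = proj₂ (proj₂ (complement-of x))

  area-complement : ∀ (x : El S) → area n (proj₁ (complement x)) ≡ size (proj₁ x)
  area-complement x = trans (cong (N ∸_) (size-complement x)) (m∸[m∸n]≡n (size≤N x))

  size-complement² : ∀ (x : El S) → size (proj₁ (complement (complement x))) ≡ size (proj₁ x)
  size-complement² x = trans (size-complement (complement x)) (area-complement x)

  complement-respects : ∀ {x y : El S} → proj₁ x ≡ proj₁ y → proj₁ (complement x) ≡ proj₁ (complement y)
  complement-respects {x} {y} e = same-size (complement x) (complement y)
    (trans (size-complement x) (trans (cong (λ γ → N ∸ size γ) e) (sym (size-complement y))))

  complement-bijection : Bijection (ElSetoid S) (ElSetoid S)
  complement-bijection = record
    { to        = complement
    ; cong      = λ {x} {y} → complement-respects {x} {y}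
    ; bijective = (λ {x} {y} → injective x y) , surjective
    }
    where
    injective : ∀ (x y : El S) → proj₁ (complement x) ≡ proj₁ (complement y) → proj₁ x ≡ proj₁ y
    injective x y e = same-size x y (∸-cancelˡ-≡ (size≤N x) (size≤N y)
      (trans (sym (size-complement x)) (trans (cong size e) (size-complement y))))
    surjective : ∀ (y : El S) → Σ (El S) λ x → ∀ {z} → proj₁ z ≡ proj₁ x → proj₁ (complement z) ≡ proj₁ y
    surjective y = complement y , λ {z} e →
      trans (complement-respects {z} {complement y} e) (same-size (complement (complement y)) y (size-complement² y))

  complement-swaps : Swaps n S S complement-bijection
  complement-swaps x =
    sym (trans (dinv≡size (proj₂ (complement x))) (size-complement x)) ,
    trans (dinv≡size (proj₂ x)) (sym (area-complement x))

  swaps-unique : ∀ h → Swaps n S S h → ∀ (x : El S) → proj₁ (Bijection.to h x) ≡ proj₁ (complement x)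
  swaps-unique h swaps x = same-size (Bijection.to h x) (complement x) (begin
    size (proj₁ (Bijection.to h x))   ≡⟨ sym (dinv≡size (proj₂ (Bijection.to h x))) ⟩
    dinv (proj₁ (Bijection.to h x))   ≡⟨ sym (proj₁ (swaps x)) ⟩
    N ∸ size (proj₁ x)                ≡⟨ sym (size-complement x) ⟩
    size (proj₁ (complement x))       ∎)
    where open ≡-Reasoning

  self-opposite : NOpposite n S S
  self-opposite = S⊆DP , S⊆DP , complement-bijection , complement-swaps , swaps-unique

lemma2p10 : ∀ (n : ℕ) → NOpposite n (C0∩DP n) (C0∩DP n)
lemma2p10 n = SelfOpposite.self-opposite n (C0∩DP n)
  (λ _ → proj₂)
  (λ c → C0-dinv≡size (proj₁ c))
  (λ c c′ → C0-size-injective (proj₁ c) (proj₁ c′))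
  (C0-realise n)
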